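{- Let $m\geq 1$. If there is an integer $n\geq 0$ with $m\leq 3^n$ such that $P(T_n,m\times m)=P(T_{n+1},m\times m)$, then $P(T_n,m\times m)=P(T_{n+k},m\times m)$ for all integers $k\geq1$, and in particular $P(T_n,m\times m)=P(T,m\times m)$.
   Context: Work over the alphabet $\{0,1\}$ and regard patterns as binary matrices. The block substitution $\mu$ maps $0$ to the $3\times3$ matrix with rows $(1,0,1),(0,0,0),(1,0,1)$ and $1$ to the $3\times3$ matrix with rows $(0,1,0),(1,1,1),(0,1,0)$; it acts on an $m\times n$ binary matrix by replacing each entry by its $3\times3$ image block. Let $T_k=\mu^k(0)$ for $k\ge 0$. The squiral tiling $T$ is the limit of the $T_k$. For a finite pattern $S$, $P(S,m\times n)$ is the set of all $m\times n$ contiguous submatrices of $S$, and $P(T,m\times n)=\bigcup_{k\ge0}P(T_k,m\times n)$. -}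

module Defs where

open import Data.Bool using (Bool; true; false; not; _∧_; _∨_)
open import Data.Nat using (ℕ; zero; suc; _+_; _^_; _≤_; _≡ᵇ_)
open import Data.Nat.DivMod using (_/_; _%_)
open import Data.Fin using (Fin; toℕ)
open import Data.Product using (Σ; _×_; _,_)
open import Relation.Binary.PropositionalEquality using (_≡_)

-- An (infinite) binary array indexed by (row, column) natural numbers;
-- a finite matrix of size r × c is its restriction to rows < r, cols < c.
Array : Set
Array = ℕ → ℕ → Bool

-- The 3×3 image of a symbol under μ, as a function of (row, col) ∈ {0,1,2}²:
-- μ(0) = [[1,0,1],[0,0,0],[1,0,1]] , μ(1) = [[0,1,0],[1,1,1],[0,1,0]].
μblock : Bool → ℕ → ℕ → Bool
μblock false a b = not (a ≡ᵇ 1) ∧ not (b ≡ᵇ 1)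
μblock true  a b = (a ≡ᵇ 1) ∨ (b ≡ᵇ 1)

μ : Array → Array
μ M i j = μblock (M (i / 3) (j / 3)) (i % 3) (j % 3)

-- T k = μ^k(0), a 3^k × 3^k matrix (entries outside that range are irrelevant).
T : ℕ → Array
T zero    = λ _ _ → false
T (suc k) = μ (T k)

Pattern : ℕ → ℕ → Set
Pattern m n = Fin m → Fin n → Bool

_∈P[T_] : ∀ {m n} → Pattern m n → ℕ → Set
_∈P[T_] {m} {n} p k =
  Σ ℕ λ i → Σ ℕ λ j → (i + m ≤ 3 ^ k) × (j + n ≤ 3 ^ k) ×
    ((a : Fin m) (b : Fin n) → p a b ≡ T k (i + toℕ a) (j + toℕ b))

_∈P[T] : ∀ {m n} → Pattern m n → Set
p ∈P[T] = Σ ℕ λ k → p ∈P[T k ]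

SameP : ℕ → ℕ → ℕ → Set
SameP m k l = (p : Pattern m m) →
  (p ∈P[T k ] → p ∈P[T l ]) × (p ∈P[T l ] → p ∈P[T k ])

SamePT : ℕ → ℕ → Set
SamePT m k = (p : Pattern m m) →
  (p ∈P[T k ] → p ∈P[T]) × (p ∈P[T] → p ∈P[T k ])

{-# OPTIONS --safe #-}
-- Every m × n window (m, n ≥ 1) of μ(A) lies inside the image μ(W) of an m × n window W of A,
-- as long as m and n do not exceed the size of A. Hence μ carries an inclusion of pattern sets
-- P(A) ⊆ P(B) to P(μ A) ⊆ P(μ B), and since T (k + 1) = μ (T k), the hypothesis
-- P(T (n + 1)) ⊆ P(T n) propagates to P(T (k + 1)) ⊆ P(T k) for every k ≥ n. The reverse
-- inclusions P(T k) ⊆ P(T (k + 1)) hold for all k because T k is the central block of T (k + 1).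
module Submission where

open import Defs
open import Data.Nat
  using (ℕ; zero; suc; _+_; _*_; _∸_; _^_; _≤_; _<_; _≤′_; ≤′-refl; ≤′-step; s≤s; s≤s⁻¹)
open import Data.Nat.Properties
open import Data.Nat.DivMod
  using (_/_; _%_; m≡m%n+[m/n]*n; m%n<n; m/n*n≤m; m*n/n≡m; m<n*o⇒m/o<n; /-congˡ; +-distrib-/-∣ˡ; %-remove-+ˡ)
open import Data.Nat.Divisibility using (m∣m*n)
open import Data.Fin using (Fin; toℕ; fromℕ<)
open import Data.Fin.Properties using (toℕ<n; toℕ-fromℕ<)
open import Data.Product using (Σ; ∃₂; _×_; _,_; proj₂)
open import Data.Sum using (inj₁; inj₂)
open import Function using (_∘_; id)
open import Relation.Binary.PropositionalEquality
open import Relation.Nullary using (yes; no)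

private
  variable
    A B : Array
    a d e i j i′ j′ k m n r s u v w w′ M N : ℕ

translate : ℕ → ℕ → Array → Array
translate i j A a b = A (i + a) (j + b)

AgreeOn : ℕ → ℕ → Array → Array → Set
AgreeOn r s A B = ∀ {a b} → a < r → b < s → A a b ≡ B a b

OccursAt : Pattern m n → Array → ℕ → ℕ → Set
OccursAt p A i j = ∀ a b → p a b ≡ A (i + toℕ a) (j + toℕ b)

Occurs : Pattern m n → Array → ℕ → Set
Occurs {m} {n} p A N = Σ ℕ λ i → Σ ℕ λ j → (i + m ≤ N) × (j + n ≤ N) × OccursAt p A i j

Patterns⊆ : ℕ → ℕ → Array → ℕ → Array → ℕ → Set
Patterns⊆ m n A N B M = (p : Pattern m n) → Occurs p A N → Occurs p B M

-- `Occurs p (T k) (3 ^ k)` unfolds to `p ∈P[T k ]`.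
_⊆[_×_]_ : ℕ → ℕ → ℕ → ℕ → Set
k ⊆[ m × n ] l = Patterns⊆ m n (T k) (3 ^ k) (T l) (3 ^ l)

[3u+a]/3≡u+a/3 : ∀ u a → (3 * u + a) / 3 ≡ u + a / 3
[3u+a]/3≡u+a/3 u a = begin
  (3 * u + a) / 3   ≡⟨ +-distrib-/-∣ˡ a (m∣m*n u) ⟩
  3 * u / 3 + a / 3 ≡⟨ cong (_+ a / 3) (trans (/-congˡ (*-comm 3 u)) (m*n/n≡m u 3)) ⟩
  u + a / 3         ∎
  where open ≡-Reasoning

[3u+a]%3≡a%3 : ∀ u a → (3 * u + a) % 3 ≡ a % 3
[3u+a]%3≡a%3 u a = %-remove-+ˡ a (m∣m*n u)

μ-translate : ∀ A u v a b → μ A (3 * u + a) (3 * v + b) ≡ μ (translate u v A) a b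
μ-translate A u v a b
  rewrite [3u+a]/3≡u+a/3 u a | [3u+a]/3≡u+a/3 v b | [3u+a]%3≡a%3 u a | [3u+a]%3≡a%3 v b = refl

<3*⇒/3< : a < 3 * r → a / 3 < r
<3*⇒/3< {a} {r} a<3r = m<n*o⇒m/o<n (subst (a <_) (*-comm 3 r) a<3r)

μ-agreeOn : AgreeOn r s A B → AgreeOn (3 * r) (3 * s) (μ A) (μ B)
μ-agreeOn A≈B a<3r b<3s = cong (λ c → μblock c _ _) (A≈B (<3*⇒/3< a<3r) (<3*⇒/3< b<3s))

μ-agreeOn-translate : AgreeOn r s (translate u v A) (translate w w′ B) →
  AgreeOn (3 * r) (3 * s) (translate (3 * u) (3 * v) (μ A)) (translate (3 * w) (3 * w′) (μ B))
μ-agreeOn-translate {u = u} {v} {A} {w} {w′} {B} A≈B {a} {b} a<3r b<3s = begin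
  μ A (3 * u + a) (3 * v + b)   ≡⟨ μ-translate A u v a b ⟩
  μ (translate u v A) a b       ≡⟨ μ-agreeOn A≈B a<3r b<3s ⟩
  μ (translate w w′ B) a b      ≡⟨ μ-translate B w w′ a b ⟨
  μ B (3 * w + a) (3 * w′ + b)  ∎
  where open ≡-Reasoning

-- μ(0) has a 0 in its centre, so T (k + 1) = μ^k(μ(0)) has T k = μ^k(0) as its central block.
T-center : ∀ k → AgreeOn (3 ^ k) (3 ^ k) (T k) (translate (3 ^ k) (3 ^ k) (T (suc k)))
T-center zero {zero}  {zero}  _         _         = refl
T-center zero {suc _} {_}     (s≤s ()) _
T-center zero {zero}  {suc _} _         (s≤s ())
T-center (suc k) {a} {b} a< b< = begin
  μ (T k) a b                                         ≡⟨ μ-agreeOn (T-center k) a< b< ⟩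
  μ (translate (3 ^ k) (3 ^ k) (T (suc k))) a b       ≡⟨ μ-translate (T (suc k)) (3 ^ k) (3 ^ k) a b ⟨
  μ (T (suc k)) (3 * 3 ^ k + a) (3 * 3 ^ k + b)       ∎
  where open ≡-Reasoning

+toℕ< : d + m ≤ r → (a : Fin m) → d + toℕ a < r
+toℕ< {d} d+m≤r a = <-≤-trans (+-monoʳ-< d (toℕ<n a)) d+m≤r

occursAt-transport : AgreeOn r s (translate i j A) (translate i′ j′ B) → d + m ≤ r → e + n ≤ s →
  {p : Pattern m n} → OccursAt p A (i + d) (j + e) → OccursAt p B (i′ + d) (j′ + e)
occursAt-transport {i = i} {j} {A} {i′} {j′} {B} {d} {e = e} A≈B d+m≤r e+n≤s {p} p≡ a b = begin
  p a b                                 ≡⟨ p≡ a b ⟩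
  A (i + d + toℕ a) (j + e + toℕ b)     ≡⟨ cong₂ A (+-assoc i d _) (+-assoc j e _) ⟩
  A (i + (d + toℕ a)) (j + (e + toℕ b)) ≡⟨ A≈B (+toℕ< d+m≤r a) (+toℕ< e+n≤s b) ⟩
  B (i′ + (d + toℕ a)) (j′ + (e + toℕ b)) ≡⟨ cong₂ B (+-assoc i′ d _) (+-assoc j′ e _) ⟨
  B (i′ + d + toℕ a) (j′ + e + toℕ b)   ∎
  where open ≡-Reasoning

agreeOn-fromFin : ((a : Fin r) (b : Fin s) → A (toℕ a) (toℕ b) ≡ B (toℕ a) (toℕ b)) → AgreeOn r s A B
agreeOn-fromFin {r} {s} {A} {B} A≡B a<r b<s =
  subst₂ (λ (a b : ℕ) → A a b ≡ B a b) (toℕ-fromℕ< a<r) (toℕ-fromℕ< b<s) (A≡B (fromℕ< a<r) (fromℕ< b<s))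

T-⊆-suc : ∀ k → k ⊆[ m × n ] suc k
T-⊆-suc {m} {n} k p (i , j , i+m≤ , j+n≤ , p≡) =
  3 ^ k + i , 3 ^ k + j , centred i+m≤ , centred j+n≤ ,
  occursAt-transport {i = 0} {0} {T k} {3 ^ k} {3 ^ k} {T (suc k)} (T-center k) i+m≤ j+n≤ p≡
  where
  centred : ∀ {i l} → i + l ≤ 3 ^ k → 3 ^ k + i + l ≤ 3 ^ suc k
  centred {i} {l} i+l≤ = begin
    3 ^ k + i + l           ≡⟨ +-assoc (3 ^ k) i l ⟩
    3 ^ k + (i + l)         ≤⟨ +-monoʳ-≤ (3 ^ k) (≤-trans i+l≤ (m≤m+n (3 ^ k) _)) ⟩
    3 * 3 ^ k               ∎
    where open ≤-Reasoning

T-⊆-mono : j ≤′ k → j ⊆[ m × n ] k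
T-⊆-mono ≤′-refl            _ = id
T-⊆-mono (≤′-step {k} j≤k) p = T-⊆-suc k p ∘ T-⊆-mono j≤k p

-- The witness is u = min (i / 3) (N ∸ m): the window of A starting at block u must itself fit in N.
split-window : 1 ≤ m → m ≤ N → i + m ≤ 3 * N →
  ∃₂ λ u d → i ≡ 3 * u + d × d + m ≤ 3 * m × u + m ≤ N
split-window {m} {N} {i} 1≤m m≤N i+m≤3N with i / 3 + m ≤? N
... | yes i/3+m≤N = i / 3 , i % 3 , i≡3[i/3]+i%3 , i%3+m≤3m , i/3+m≤N
  where
  i≡3[i/3]+i%3 : i ≡ 3 * (i / 3) + i % 3
  i≡3[i/3]+i%3 = trans (m≡m%n+[m/n]*n i 3) (trans (+-comm (i % 3) _) (cong (_+ i % 3) (*-comm (i / 3) 3)))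
  i%3+m≤3m : i % 3 + m ≤ 3 * m
  i%3+m≤3m = begin
    i % 3 + m ≤⟨ +-monoˡ-≤ m (s≤s⁻¹ (m%n<n i 3)) ⟩
    2 + m     ≤⟨ +-monoˡ-≤ m (*-monoʳ-≤ 2 1≤m) ⟩
    2 * m + m ≡⟨ +-comm (2 * m) m ⟩
    3 * m     ∎
    where open ≤-Reasoning
... | no i/3+m≰N = ū , i ∸ 3 * ū , sym (m+[n∸m]≡n 3ū≤i) , d+m≤3m , ≤-reflexive ū+m≡N
  where
  ū : ℕ
  ū = N ∸ m
  ū+m≡N : ū + m ≡ N
  ū+m≡N = m∸n+n≡m m≤N
  ū<i/3 : ū < i / 3
  ū<i/3 = +-cancelʳ-< m ū (i / 3) (subst (_< i / 3 + m) (sym ū+m≡N) (≰⇒> i/3+m≰N))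
  3ū≤i : 3 * ū ≤ i
  3ū≤i = begin
    3 * ū       ≤⟨ *-monoʳ-≤ 3 (<⇒≤ ū<i/3) ⟩
    3 * (i / 3) ≡⟨ *-comm 3 (i / 3) ⟩
    i / 3 * 3   ≤⟨ m/n*n≤m i 3 ⟩
    i           ∎
    where open ≤-Reasoning
  d+m≤3m : i ∸ 3 * ū + m ≤ 3 * m
  d+m≤3m = +-cancelˡ-≤ (3 * ū) _ _ (begin
    3 * ū + (i ∸ 3 * ū + m) ≡⟨ +-assoc (3 * ū) _ m ⟨
    3 * ū + (i ∸ 3 * ū) + m ≡⟨ cong (_+ m) (m+[n∸m]≡n 3ū≤i) ⟩
    i + m                   ≤⟨ i+m≤3N ⟩
    3 * N                   ≡⟨ cong (3 *_) ū+m≡N ⟨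
    3 * (ū + m)             ≡⟨ *-distribˡ-+ 3 ū m ⟩
    3 * ū + 3 * m           ∎)
    where open ≤-Reasoning

μ-preserves-Patterns⊆ : 1 ≤ m → 1 ≤ n → m ≤ N → n ≤ N →
  Patterns⊆ m n A N B M → Patterns⊆ m n (μ A) (3 * N) (μ B) (3 * M)
μ-preserves-Patterns⊆ {m} {n} {N} {A} {B} {M} 1≤m 1≤n m≤N n≤N A⊆B p (i , j , i+m≤ , j+n≤ , p≡)
  with split-window 1≤m m≤N i+m≤ | split-window 1≤n n≤N j+n≤
... | u , d , refl , d+m≤ , u+m≤ | v , e , refl , e+n≤ , v+n≤
  with A⊆B (λ a b → A (u + toℕ a) (v + toℕ b)) (u , v , u+m≤ , v+n≤ , λ _ _ → refl)
... | w , w′ , w+m≤ , w′+n≤ , q≡ =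
  3 * w + d , 3 * w′ + e , block-bound d m w d+m≤ w+m≤ , block-bound e n w′ e+n≤ w′+n≤ ,
  occursAt-transport {i = 3 * u} {3 * v} {μ A} {3 * w} {3 * w′} {μ B}
    (μ-agreeOn-translate {u = u} {v} {A} {w} {w′} {B} (agreeOn-fromFin q≡))
    d+m≤ e+n≤ p≡
  where
  block-bound : ∀ d l w → d + l ≤ 3 * l → w + l ≤ M → 3 * w + d + l ≤ 3 * M
  block-bound d l w d+l≤3l w+l≤M = begin
    3 * w + d + l   ≡⟨ +-assoc (3 * w) d l ⟩
    3 * w + (d + l) ≤⟨ +-monoʳ-≤ (3 * w) d+l≤3l ⟩
    3 * w + 3 * l   ≡⟨ *-distribˡ-+ 3 w l ⟨
    3 * (w + l)     ≤⟨ *-monoʳ-≤ 3 w+l≤M ⟩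
    3 * M           ∎
    where open ≤-Reasoning

module Stabilisation (1≤m : 1 ≤ m) (1≤n : 1 ≤ n) (m≤3^j : m ≤ 3 ^ j) (n≤3^j : n ≤ 3 ^ j)
                     (settled : suc j ⊆[ m × n ] j) where

  suc-⊆ : j ≤′ k → suc k ⊆[ m × n ] k
  suc-⊆ ≤′-refl = settled
  suc-⊆ (≤′-step {k} j≤k) =
    μ-preserves-Patterns⊆ {A = T (suc k)} {T k} 1≤m 1≤n (grow m≤3^j) (grow n≤3^j) (suc-⊆ j≤k)
    where
    grow : ∀ {l} → l ≤ 3 ^ j → l ≤ 3 ^ suc k
    grow l≤ = ≤-trans l≤ (^-monoʳ-≤ 3 (≤′⇒≤ (≤′-step j≤k)))

  ≥-⊆ : j ≤′ k → k ⊆[ m × n ] j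
  ≥-⊆ ≤′-refl _ = id
  ≥-⊆ (≤′-step {k} j≤k) p = ≥-⊆ j≤k p ∘ suc-⊆ j≤k p

  all-⊆ : ∀ k → k ⊆[ m × n ] j
  all-⊆ k with ≤-total k j
  ... | inj₁ k≤j = T-⊆-mono (≤⇒≤′ k≤j)
  ... | inj₂ j≤k = ≥-⊆ (≤⇒≤′ j≤k)

lemma2 : (m : ℕ) → 1 ≤ m → (n : ℕ) → m ≤ 3 ^ n → SameP m n (n + 1) →
    ((k : ℕ) → 1 ≤ k → SameP m n (n + k)) × SamePT m n
lemma2 m 1≤m n m≤3^n same = (λ k _ p → T-⊆-mono (n≤′n+k k) p , ≥-⊆ (n≤′n+k k) p) ,
                            λ p → (λ x → n , x) , λ (k , x) → all-⊆ k p x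
  where
  settled : suc n ⊆[ m × m ] n
  settled p = proj₂ (same p) ∘ subst (_∈P[T_] p) (+-comm 1 n)
  open Stabilisation {j = n} 1≤m 1≤m m≤3^n m≤3^n settled
  n≤′n+k : ∀ k → n ≤′ n + k
  n≤′n+k k = ≤⇒≤′ (m≤m+n n k)
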